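{- Let $G$ be a maximal outerplanar graph with boundary cycle $\mathcal{C}$, and let $ab\in E(\mathcal{C})$. Let $G'$ be the maximal outerplanar graph obtained from $G$ by subdividing the edge $ab$ (deleting $ab$ and adding a new vertex $c$ together with edges $ac$ and $cb$, which become edges of the new boundary cycle) and then adding the chord $ab$. Then \[ TCL(G')=\begin{cases} TCL(G)+2+n_G(ab), & \text{if } G \text{ has no diameter},\\ TCL(G)+\tfrac32+n_G(ab), & \text{if } G \text{ has a diameter}.\end{cases} \]
   Context: A maximal outerplanar graph of order $n$ is regarded as a drawing consisting of an $n$-cycle $\mathcal{C}$ together with a triangulation (by non-crossing edges between vertices of $\mathcal{C}$) of the bounded region determined by $\mathcal{C}$. Edges not in $\mathcal{C}$ are chords; the length of a chord is the length of a shortest path in $\mathcal{C}$ between its endpoints; $TCL(G)$ is the sum of the lengths of all chords. A diameter is a chord of length $n/2$. For an edge $ab\in E(\mathcal{C})$: if $G$ has no diameter, $n_G(ab)$ is the number of chords of $G$ whose length is computed along a (shortest) path in $\mathcal{C}$ that includes $ab$; if $G$ has a diameter, $n_G(ab)$ is $\tfrac12$ plus the number of chords of $G$ other than the diameter whose length is computed along a path in $\mathcal{C}$ that includes $ab$. -}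

module Defs where

open import Data.Nat
open import Data.Bool using (Bool; true; false; if_then_else_; _∧_; _∨_; not)
open import Data.List using (List; []; _∷_; map)
open import Data.Nat.ListAction using (sum)
open import Data.Bool.ListAction using (any)
open import Data.List.Membership.Propositional using (_∈_)
open import Data.List.Relation.Unary.All using (All)
open import Data.List.Relation.Unary.Any using (Any)
open import Data.List.Relation.Unary.AllPairs using (AllPairs)
open import Data.List.Relation.Unary.Unique.Propositional using (Unique)
open import Data.Product using (_×_; _,_)
open import Data.Sum using (_⊎_)
open import Relation.Nullary using (¬_)
open import Relation.Binary.PropositionalEquality using (_≡_)

-- Vertices of the boundary n-cycle C are 0,1,…,n-1 in cyclic order;
-- C has edges {i, i+1} (i < n-1) and {n-1, 0}.
-- A chord is stored as a pair (i , j) with i < j.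
Chord : Set
Chord = ℕ × ℕ

IsChord : ℕ → Chord → Set
IsChord n (i , j) = (i + 2 ≤ j) × (j < n) × ¬ ((i ≡ 0) × (suc j ≡ n))

Cross : Chord → Chord → Set
Cross (a , b) (c , d) = ((a < c) × (c < b) × (b < d)) ⊎ ((c < a) × (a < d) × (d < b))

-- Maximal outerplanar graph of order n: n-cycle plus a triangulation of its
-- interior, i.e. a maximal set of pairwise non-crossing chords.
record MOP (n : ℕ) : Set where
  field
    order≥3     : 3 ≤ n
    chords      : List Chord
    valid       : All (IsChord n) chords
    distinct    : Unique chords
    noncrossing : AllPairs (λ x y → ¬ Cross x y) chords
    maximal     : ∀ c → IsChord n c → ¬ (c ∈ chords) → Any (Cross c) chords
open MOP public

-- length of chord (i , j) in the n-cycle: shortest cycle distance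
chordLength : ℕ → Chord → ℕ
chordLength n (i , j) = (j ∸ i) ⊓ (n ∸ (j ∸ i))

tcl : ℕ → List Chord → ℕ
tcl n cs = sum (map (chordLength n) cs)

TCL : ∀ {n} → MOP n → ℕ
TCL {n} G = tcl n (chords G)

isDiameter : ℕ → Chord → Bool
isDiameter n (i , j) = (2 * (j ∸ i)) ≡ᵇ n

hasDiameter : ∀ {n} → MOP n → Bool
hasDiameter {n} G = any (isDiameter n) (chords G)

-- The cycle edge ab indexed by k < n is {k, (k+1) mod n}.
-- The arc i,i+1,…,j (of length j-i) contains edge k iff i ≤ k < j;
-- the complementary arc (length n-(j-i)) contains it otherwise.
inInnerArc : ℕ → Chord → Bool
inInnerArc k (i , j) = (i ≤ᵇ k) ∧ (k <ᵇ j)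

-- chord (not a diameter) whose length is computed along a shortest path
-- in C containing edge k
countedAt : ℕ → ℕ → Chord → Bool
countedAt n k c@(i , j) =
  ((2 * (j ∸ i) <ᵇ n) ∧ inInnerArc k c) ∨ ((n <ᵇ 2 * (j ∸ i)) ∧ not (inInnerArc k c))

countAt : ℕ → ℕ → List Chord → ℕ
countAt n k cs = sum (map (λ c → if countedAt n k c then 1 else 0) cs)

-- twice n_G(ab), to stay in ℕ (n_G(ab) may be a half-integer)
twiceNG : ∀ {n} → MOP n → ℕ → ℕ
twiceNG {n} G k =
  (if hasDiameter G then 1 else 0) + 2 * countAt n k (chords G)

-- Subdividing edge k: new vertex c = k+1 is inserted after k; old vertices
-- v > k are relabelled v+1 (for k = n-1, c = n and nothing is relabelled).
shiftV : ℕ → ℕ → ℕ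
shiftV k v = if v ≤ᵇ k then v else suc v

shiftChord : ℕ → Chord → Chord
shiftChord k (i , j) = (shiftV k i , shiftV k j)

newChord : ℕ → ℕ → Chord
newChord n k = if suc k <ᵇ n then (k , suc (suc k)) else (0 , k)

subdivChords : ∀ {n} → MOP n → ℕ → List Chord
subdivChords {n} G k = newChord n k ∷ map (shiftChord k) (chords G)

TCL' : ∀ {n} → MOP n → ℕ → ℕ
TCL' {n} G k = tcl (suc n) (subdivChords G k)

{-# OPTIONS --safe #-}
-- Subdividing edge ab lengthens by one the arc of each old chord that contains ab and leaves
-- its other arc unchanged. A chord with arcs d and n - d has length d ⊓ (n - d), so it grows
-- by one exactly when the lengthened arc was the strictly shorter one, i.e. when the chord is
-- counted in n_G(ab); a diameter keeps its length. The added chord ab has length 2, hence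
-- TCL(G') = TCL(G) + 2 + #counted chords, and the extra 1/2 that n_G(ab) carries when G has
-- a diameter turns the constant 2 into 3/2.
module Submission where

open import Defs
open import Data.Nat using (ℕ; _<_; _+_; _*_)
open import Data.Bool using (true; false)
open import Data.Product using (_×_)
open import Relation.Binary.PropositionalEquality using (_≡_)

open import Data.Bool using (Bool; if_then_else_; _∧_; _∨_; not)
open import Data.List using (_∷_; map)
open import Data.List.Properties using (map-∘)
open import Data.List.Relation.Unary.All using (All; []; _∷_)
open import Data.Nat using (zero; suc; _≤_; _⊓_; _∸_; _<ᵇ_; _≤ᵇ_; s≤s⁻¹)
open import Data.Nat.ListAction using (sum)
open import Data.Nat.Properties
open import Algebra.Properties.CommutativeSemigroup +-commutativeSemigroup using (interchange)
open import Data.Nat.Tactic.RingSolver using (solve-∀)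
open import Data.Product using (_,_)
open import Function using (_∘_)
open import Relation.Nullary using (contradiction)
open import Relation.Nullary.Reflects using (ofʸ; ofⁿ)
open import Relation.Binary.PropositionalEquality using (refl; sym; cong; cong₂; module ≡-Reasoning)

open ≡-Reasoning

indicator : Bool → ℕ
indicator b = if b then 1 else 0

∧-∨-∧-not : ∀ x y b → (x ∧ b) ∨ (y ∧ not b) ≡ (if b then x else y)
∧-∨-∧-not true  true  true  = refl
∧-∨-∧-not true  false true  = refl
∧-∨-∧-not false true  true  = refl
∧-∨-∧-not false false true  = refl
∧-∨-∧-not true  true  false = refl
∧-∨-∧-not true  false false = refl
∧-∨-∧-not false true  false = refl
∧-∨-∧-not false false false = refl

sum-map-+ : ∀ {A : Set} {P : A → Set} (f g h : A → ℕ) →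
            (∀ {x} → P x → f x ≡ g x + h x) →
            ∀ {xs} → All P xs → sum (map f xs) ≡ sum (map g xs) + sum (map h xs)
sum-map-+ f g h split []                  = refl
sum-map-+ f g h split {x ∷ xs} (px ∷ pxs) = begin
  f x + sum (map f xs)                               ≡⟨ cong₂ _+_ (split px) (sum-map-+ f g h split pxs) ⟩
  (g x + h x) + (sum (map g xs) + sum (map h xs))    ≡⟨ interchange (g x) (h x) _ _ ⟩
  (g x + sum (map g xs)) + (h x + sum (map h xs))    ∎

+-cancelˡ-<ᵇ : ∀ m a b → (m + a <ᵇ m + b) ≡ (a <ᵇ b)
+-cancelˡ-<ᵇ zero    a b = refl
+-cancelˡ-<ᵇ (suc m) a b = +-cancelˡ-<ᵇ m a b

suc-⊓ : ∀ d e → suc d ⊓ e ≡ d ⊓ e + indicator (d <ᵇ e)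
suc-⊓ zero    zero    = refl
suc-⊓ (suc d) zero    = refl
suc-⊓ zero    (suc e) = refl
suc-⊓ (suc d) (suc e) = cong suc (suc-⊓ d e)

⊓-suc : ∀ d e → d ⊓ suc e ≡ d ⊓ e + indicator (e <ᵇ d)
⊓-suc zero          e    = refl
⊓-suc (suc zero)    zero = refl
⊓-suc (suc (suc d)) zero = refl
⊓-suc (suc d) (suc e)    = cong suc (⊓-suc d e)

module _ {d n : ℕ} (d≤n : d ≤ n) where

  private
    n≡d+[n∸d] : n ≡ d + (n ∸ d)
    n≡d+[n∸d] = sym (m+[n∸m]≡n d≤n)

    2*d≡d+d : 2 * d ≡ d + d
    2*d≡d+d = cong (d +_) (+-identityʳ d)

  <ᵇ-complement : (d <ᵇ n ∸ d) ≡ (2 * d <ᵇ n)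
  <ᵇ-complement = begin
    d <ᵇ n ∸ d               ≡⟨ sym (+-cancelˡ-<ᵇ d d (n ∸ d)) ⟩
    d + d <ᵇ d + (n ∸ d)     ≡⟨ cong₂ _<ᵇ_ (sym 2*d≡d+d) (sym n≡d+[n∸d]) ⟩
    2 * d <ᵇ n               ∎

  >ᵇ-complement : (n ∸ d <ᵇ d) ≡ (n <ᵇ 2 * d)
  >ᵇ-complement = begin
    n ∸ d <ᵇ d               ≡⟨ sym (+-cancelˡ-<ᵇ d (n ∸ d) d) ⟩
    d + (n ∸ d) <ᵇ d + d     ≡⟨ cong₂ _<ᵇ_ (sym n≡d+[n∸d]) (sym 2*d≡d+d) ⟩
    n <ᵇ 2 * d               ∎

  inner-arc-grows : suc d ⊓ (suc n ∸ suc d) ≡ d ⊓ (n ∸ d) + indicator (2 * d <ᵇ n)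
  inner-arc-grows = begin
    suc d ⊓ (n ∸ d)                         ≡⟨ suc-⊓ d (n ∸ d) ⟩
    d ⊓ (n ∸ d) + indicator (d <ᵇ n ∸ d)    ≡⟨ cong (λ b → d ⊓ (n ∸ d) + indicator b) <ᵇ-complement ⟩
    d ⊓ (n ∸ d) + indicator (2 * d <ᵇ n)    ∎

  outer-arc-grows : d ⊓ (suc n ∸ d) ≡ d ⊓ (n ∸ d) + indicator (n <ᵇ 2 * d)
  outer-arc-grows = begin
    d ⊓ (suc n ∸ d)                         ≡⟨ cong (d ⊓_) (+-∸-assoc 1 d≤n) ⟩
    d ⊓ suc (n ∸ d)                         ≡⟨ ⊓-suc d (n ∸ d) ⟩
    d ⊓ (n ∸ d) + indicator (n ∸ d <ᵇ d)    ≡⟨ cong (λ b → d ⊓ (n ∸ d) + indicator b) >ᵇ-complement ⟩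
    d ⊓ (n ∸ d) + indicator (n <ᵇ 2 * d)    ∎

countedAt≡if-inInnerArc : ∀ n k i j → countedAt n k (i , j) ≡
  (if inInnerArc k (i , j) then 2 * (j ∸ i) <ᵇ n else n <ᵇ 2 * (j ∸ i))
countedAt≡if-inInnerArc n k i j = ∧-∨-∧-not (2 * (j ∸ i) <ᵇ n) (n <ᵇ 2 * (j ∸ i)) (inInnerArc k (i , j))

shiftChord-length : ∀ {n} k {i j} → i ≤ j → j ∸ i ≤ n →
  chordLength (suc n) (shiftChord k (i , j)) ≡ chordLength n (i , j) + indicator (countedAt n k (i , j))
shiftChord-length {n} k {i} {j} i≤j d≤n
  rewrite countedAt≡if-inInnerArc n k i j
  -- edge k lies on the arc i, …, j iff i ≤ k < j; exactly the endpoints above k are relabelled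
  with i ≤ᵇ k | ≤ᵇ-reflects-≤ i k | j ≤ᵇ k | ≤ᵇ-reflects-≤ j k | k <ᵇ j | <ᵇ-reflects-< k j
... | true  | _        | true  | ofʸ j≤k | true  | ofʸ k<j = contradiction j≤k (<⇒≱ k<j)
... | true  | _        | true  | _       | false | _       = outer-arc-grows d≤n
... | true  | _        | false | _       | true  | _       rewrite +-∸-assoc 1 i≤j = inner-arc-grows d≤n
... | true  | _        | false | ofⁿ j≰k | false | ofⁿ k≮j = contradiction (≮⇒≥ k≮j) j≰k
... | false | ofⁿ i≰k  | true  | ofʸ j≤k | _     | _       = contradiction (≤-trans i≤j j≤k) i≰k
... | false | _        | false | _       | _     | _       = outer-arc-grows d≤n

newChord-length : ∀ {n k} → 3 ≤ n → k < n → chordLength (suc n) (newChord n k) ≡ 2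
newChord-length {n} {k} 3≤n k<n with suc k <ᵇ n | <ᵇ-reflects-< (suc k) n
... | true  | _            rewrite m+n∸n≡m 2 k = m≤n⇒m⊓n≡m (∸-monoˡ-≤ 1 3≤n)
... | false | ofⁿ 1+k≮n    with ≤-antisym k<n (≮⇒≥ 1+k≮n)
...   | refl               rewrite m+n∸n≡m 2 k = m≥n⇒m⊓n≡n (s≤s⁻¹ 3≤n)

tcl-shiftChord : ∀ {n} k {cs} → All (IsChord n) cs →
  tcl (suc n) (map (shiftChord k) cs) ≡ tcl n cs + countAt n k cs
tcl-shiftChord {n} k {cs} valid = begin
  sum (map (chordLength (suc n)) (map (shiftChord k) cs))  ≡⟨ cong sum (map-∘ cs) ⟨
  sum (map (chordLength (suc n) ∘ shiftChord k) cs)        ≡⟨ sum-map-+ _ (chordLength n) (indicator ∘ countedAt n k) shift-length valid ⟩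
  tcl n cs + countAt n k cs                                ∎
  where
  shift-length : ∀ {c} → IsChord n c →
    chordLength (suc n) (shiftChord k c) ≡ chordLength n c + indicator (countedAt n k c)
  shift-length {i , j} (i+2≤j , j<n , _) =
    shiftChord-length k (≤-trans (m≤m+n i 2) i+2≤j) (≤-trans (m∸n≤m j i) (<⇒≤ j<n))

TCL'≡2+TCL+countAt : ∀ {n} (G : MOP n) {k} → k < n → TCL' G k ≡ 2 + (TCL G + countAt n k (chords G))
TCL'≡2+TCL+countAt G k<n = cong₂ _+_ (newChord-length (order≥3 G) k<n) (tcl-shiftChord _ (valid G))

lemma1 : ∀ (n : ℕ) (G : MOP n) (k : ℕ) → k < n →
    (hasDiameter G ≡ false → 2 * TCL' G k ≡ 2 * TCL G + 4 + twiceNG G k)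
    × (hasDiameter G ≡ true → 2 * TCL' G k ≡ 2 * TCL G + 3 + twiceNG G k)
lemma1 n G k k<n = without-diameter , with-diameter
  where
  2*[2+[t+c]]≡2*t+4+2*c : ∀ t c → 2 * (2 + (t + c)) ≡ 2 * t + 4 + 2 * c
  2*[2+[t+c]]≡2*t+4+2*c = solve-∀

  2*[2+[t+c]]≡2*t+3+[1+2*c] : ∀ t c → 2 * (2 + (t + c)) ≡ 2 * t + 3 + (1 + 2 * c)
  2*[2+[t+c]]≡2*t+3+[1+2*c] = solve-∀

  without-diameter : hasDiameter G ≡ false → 2 * TCL' G k ≡ 2 * TCL G + 4 + twiceNG G k
  without-diameter noDiameter rewrite TCL'≡2+TCL+countAt G k<n | noDiameter =
    2*[2+[t+c]]≡2*t+4+2*c (TCL G) (countAt n k (chords G))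

  with-diameter : hasDiameter G ≡ true → 2 * TCL' G k ≡ 2 * TCL G + 3 + twiceNG G k
  with-diameter diameter rewrite TCL'≡2+TCL+countAt G k<n | diameter =
    2*[2+[t+c]]≡2*t+3+[1+2*c] (TCL G) (countAt n k (chords G))
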